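{- Let $G$ be a connected graph with vertex set $X$. If $N$ is a network on $X$ representing $G$, then $\mathrm{ecc}(G)\le r(N)$.
   Context: In a digraph, a leaf is a vertex of indegree 1 and outdegree 0, a root is a vertex of indegree 0. A network on $X$ ($|X|\ge2$) is a simple acyclic digraph $N$ whose underlying undirected graph is connected, whose set of leaves is $X$, in which every vertex of indegree 0 has outdegree at least 2, every vertex of outdegree 0 has indegree 1, and no vertex has both indegree and outdegree equal to 1. $r(N)$ is the number of roots. $N$ represents $G$ if $G$ equals the graph on $X$ in which distinct $x,y$ are adjacent iff some vertex of $N$ has directed paths (possibly of length 0) to both. A clique is a set of at least 2 pairwise adjacent vertices; an edge clique cover of $G$ is a set of cliques such that every edge lies in one of them; $\mathrm{ecc}(G)$ is the minimum size of an edge clique cover. -}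

module Defs where

open import Data.Nat using (ℕ; _≤_; _≡ᵇ_)
open import Data.Bool using (Bool; true; false; if_then_else_; T)
open import Data.Fin using (Fin)
open import Data.Fin.Subset using (Subset; _∈_; ∣_∣)
open import Data.List using (List; allFin; map; length)
open import Data.Nat.ListAction using (sum)
open import Data.List.Membership.Propositional renaming (_∈_ to _∈ₗ_)
open import Data.Product using (Σ; ∃; ∃-syntax; _×_)
open import Data.Sum using (_⊎_)
open import Function using (flip)
open import Function.Definitions using (Injective)
open import Function.Bundles using (_⇔_)
open import Relation.Binary.PropositionalEquality using (_≡_; _≢_)
open import Relation.Binary.Construct.Closure.ReflexiveTransitive using (Star)
open import Relation.Binary.Construct.Closure.Transitive using (TransClosure)
open import Relation.Nullary using (¬_)

record Graph (n : ℕ) : Set₁ where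
  field
    Adj   : Fin n → Fin n → Set
    sym   : ∀ {x y} → Adj x y → Adj y x
    irrefl : ∀ {x} → ¬ Adj x x

open Graph public

Connected : ∀ {n} → Graph n → Set
Connected {n} G = ∀ (x y : Fin n) → Star (Adj G) x y

IsClique : ∀ {n} → Graph n → Subset n → Set
IsClique G C = (2 ≤ ∣ C ∣) × (∀ x y → x ∈ C → y ∈ C → x ≢ y → Adj G x y)

IsEdgeCliqueCover : ∀ {n} → Graph n → List (Subset n) → Set
IsEdgeCliqueCover G Cs =
  (∀ C → C ∈ₗ Cs → IsClique G C) ×
  (∀ x y → Adj G x y → ∃[ C ] (C ∈ₗ Cs × x ∈ C × y ∈ C))

-- ecc(G) ≤ k  (ecc is the minimum size of an edge clique cover)
ecc≤ : ∀ {n} → Graph n → ℕ → Set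
ecc≤ G k = ∃[ Cs ] (IsEdgeCliqueCover G Cs × length Cs ≤ k)

Digraph : ℕ → Set
Digraph m = Fin m → Fin m → Bool

module _ {m : ℕ} (D : Digraph m) where

  Arc : Fin m → Fin m → Set
  Arc u v = T (D u v)

  indeg : Fin m → ℕ
  indeg v = sum (map (λ u → if D u v then 1 else 0) (allFin m))

  outdeg : Fin m → ℕ
  outdeg u = sum (map (λ v → if D u v then 1 else 0) (allFin m))

  IsLeaf : Fin m → Set
  IsLeaf v = (indeg v ≡ 1) × (outdeg v ≡ 0)

  IsRoot : Fin m → Set
  IsRoot v = indeg v ≡ 0

  numRoots : ℕ
  numRoots = sum (map (λ v → if indeg v ≡ᵇ 0 then 1 else 0) (allFin m))

  Reach : Fin m → Fin m → Set
  Reach = Star Arc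

  Acyclic : Set
  Acyclic = ∀ v → ¬ TransClosure Arc v v

  NoLoops : Set
  NoLoops = ∀ v → ¬ Arc v v

  WeaklyConnected : Set
  WeaklyConnected = ∀ u v → Star (λ a b → Arc a b ⊎ Arc b a) u v

record IsNetwork (n m : ℕ) (D : Digraph m) (leaf : Fin n → Fin m) : Set where
  field
    two≤n       : 2 ≤ n
    noLoops     : NoLoops D
    acyclic     : Acyclic D
    connected   : WeaklyConnected D
    leaf-inj    : Injective _≡_ _≡_ leaf
    leaves      : ∀ v → IsLeaf D v ⇔ (∃[ x ] leaf x ≡ v)
    root-out    : ∀ v → indeg D v ≡ 0 → 2 ≤ outdeg D v
    sink-in     : ∀ v → outdeg D v ≡ 0 → indeg D v ≡ 1
    no-deg11    : ∀ v → ¬ ((indeg D v ≡ 1) × (outdeg D v ≡ 1))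

Represents : ∀ {n m} → Digraph m → (Fin n → Fin m) → Graph n → Set
Represents D leaf G =
  ∀ x y → x ≢ y → Adj G x y ⇔ (∃[ v ] (Reach D v (leaf x) × Reach D v (leaf y)))

{-# OPTIONS --safe #-}
module Submission where

-- Every vertex of an acyclic finite digraph lies below a root, since ancestors cannot be
-- chased forever.  So if some vertex lies above both x and y, then so does a root ρ, and
-- x, y both belong to the set of leaves below ρ.  Conversely ρ itself witnesses that any two
-- leaves below it are adjacent.  Hence the sets of leaves below the roots, minus those with
-- fewer than two elements, form an edge clique cover with at most r(N) members.

open import Defs hiding (sym)
open import Level using (0ℓ)
open import Data.Nat using (ℕ; zero; suc; _≤_; _<_; _≡ᵇ_; z≤n; s≤s)
open import Data.Nat.Properties using (≤-trans; n<1+n; m≤n+m; +-mono-≤) renaming (_≟_ to _≟ℕ_; _≤?_ to _≤?ℕ_)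
open import Data.Nat.ListAction using (sum)
open import Data.Bool using (true; false; if_then_else_; T)
open import Data.Fin using (Fin; zero; suc) renaming (_<_ to _<ᶠ_)
open import Data.Fin.Properties using (pigeonhole; any?; _≟_)
open import Data.Fin.Subset using (Subset; _∈_; ∣_∣; ⁅_⁆)
open import Data.Fin.Subset.Properties using (x∈⁅y⁆⇒x≡y; ∣⁅x⁆∣≡1; p⊂q⇒∣p∣<∣q∣)
open import Data.Vec using (tabulate)
open import Data.Vec.Properties using ([]=⇒lookup; lookup⇒[]=; lookup∘tabulate)
open import Data.List using (List; []; _∷_; allFin; map; filter; length)
open import Data.List.Properties using (length-map)
open import Data.List.Membership.Propositional renaming (_∈_ to _∈ₗ_)
open import Data.List.Membership.Propositional.Properties using (∈-allFin; ∈-map∘filter⁺; ∈-map∘filter⁻)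
open import Data.Product using (∃; ∃-syntax; Σ-syntax; _×_; _,_; proj₁; proj₂)
open import Data.Sum using (_⊎_; inj₁; inj₂)
open import Function using (_∘_; const)
open import Function.Bundles using (Equivalence; _⇔_; mk⇔)
open import Induction.WellFounded using (Acc; acc; WellFounded)
open import Relation.Binary using (Rel; Decidable)
open import Relation.Binary.PropositionalEquality using (_≡_; _≢_; refl; sym; trans; subst)
open import Relation.Binary.Construct.Closure.ReflexiveTransitive using (Star; ε; _◅_; _◅◅_; return)
open import Relation.Binary.Construct.Closure.Transitive using (TransClosure; [_]; _∷ʳ_)
open import Relation.Nullary using (¬_; Dec; yes; no; does; contradiction)
open import Relation.Nullary.Decidable.Core using (T?)
open import Relation.Nullary.Decidable using (dec-true; map′; _×-dec_; _⊎-dec_)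
open import Relation.Unary using (Pred)
import Relation.Unary as U

∀⊎∃ : ∀ {n} {P Q : Pred (Fin n) 0ℓ} → (∀ i → P i ⊎ Q i) → (∀ i → P i) ⊎ ∃ Q
∀⊎∃ {zero} f = inj₁ (λ ())
∀⊎∃ {suc n} f with f zero | ∀⊎∃ (f ∘ suc)
... | inj₂ q | _ = inj₂ (zero , q)
... | inj₁ _ | inj₂ (i , q) = inj₂ (suc i , q)
... | inj₁ p | inj₁ ps = inj₁ λ { zero → p ; (suc i) → ps i }

module _ {m : ℕ} {R : Rel (Fin m) 0ℓ} where

  DescendingChain : ℕ → Fin m → Set
  DescendingChain k x = Σ[ f ∈ (Fin k → Fin m) ]
    (∀ {i j : Fin k} → i <ᶠ j → TransClosure R (f j) (f i)) × (∀ i → TransClosure R (f i) x)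

  chain-extend : ∀ {k x y} → R y x → DescendingChain k y → DescendingChain (suc k) x
  chain-extend {k} {x} {y} r (f , desc , below) = g , desc′ , below′
    where
    g : Fin (suc k) → Fin m
    g zero = y
    g (suc i) = f i
    desc′ : ∀ {i j} → i <ᶠ j → TransClosure R (g j) (g i)
    desc′ {zero} {suc j} _ = below j
    desc′ {suc i} {suc j} (s≤s i<j) = desc i<j
    below′ : ∀ i → TransClosure R (g i) x
    below′ zero = [ r ]
    below′ (suc i) = below i ∷ʳ r

  acc⊎chain : Decidable R → ∀ k x → Acc R x ⊎ DescendingChain k x
  acc⊎chain R? zero x = inj₂ ((λ ()) , (λ {}) , (λ ()))
  acc⊎chain R? (suc k) x with ∀⊎∃ (λ y → accBelow (R? y x) (acc⊎chain R? k y))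
    where
    accBelow : ∀ {y} → Dec (R y x) → Acc R y ⊎ DescendingChain k y →
               (R y x → Acc R y) ⊎ (R y x × DescendingChain k y)
    accBelow (no ¬r) _ = inj₁ (λ r → contradiction r ¬r)
    accBelow (yes _) (inj₁ a) = inj₁ (const a)
    accBelow (yes r) (inj₂ c) = inj₂ (r , c)
  ... | inj₁ below = inj₁ (acc (below _))
  ... | inj₂ (y , r , c) = inj₂ (chain-extend r c)

  -- A chain of length m + 1 repeats a vertex, which closes a cycle.
  acyclic⇒wellFounded : Decidable R → (∀ v → ¬ TransClosure R v v) → WellFounded R
  acyclic⇒wellFounded R? acyclic x with acc⊎chain R? (suc m) x
  ... | inj₁ a = a
  ... | inj₂ (f , desc , _) with pigeonhole (n<1+n m) f
  ... | i , j , i<j , fi≡fj = contradiction (subst (TransClosure R (f j)) fi≡fj (desc i<j)) (acyclic (f j))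

module _ {A : Set} {T : Rel A 0ℓ} where

  star-unsnoc : ∀ {x z} → Star T x z ⇔ (x ≡ z ⊎ ∃[ y ] (Star T x y × T y z))
  star-unsnoc = mk⇔ unsnoc snoc
    where
    unsnoc : ∀ {x z} → Star T x z → x ≡ z ⊎ ∃[ y ] (Star T x y × T y z)
    unsnoc ε = inj₁ refl
    unsnoc (t ◅ ts) with unsnoc ts
    ... | inj₁ refl = inj₂ (_ , ε , t)
    ... | inj₂ (y , ts′ , t′) = inj₂ (y , t ◅ ts′ , t′)
    snoc : ∀ {x z} → x ≡ z ⊎ ∃[ y ] (Star T x y × T y z) → Star T x z
    snoc (inj₁ refl) = ε
    snoc (inj₂ (_ , ts , t)) = ts ◅◅ return t

module _ {A : Set} where

  sum-map-zero : (f : A → ℕ) → (∀ x → f x ≡ 0) → ∀ xs → sum (map f xs) ≡ 0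
  sum-map-zero f f≡0 [] = refl
  sum-map-zero f f≡0 (x ∷ xs) rewrite f≡0 x = sum-map-zero f f≡0 xs

  length-filter≤sum-map : {P : Pred A 0ℓ} (P? : U.Decidable P) (f : A → ℕ) →
                          (∀ {x} → P x → 1 ≤ f x) → ∀ xs → length (filter P? xs) ≤ sum (map f xs)
  length-filter≤sum-map P? f P⇒1≤f [] = z≤n
  length-filter≤sum-map P? f P⇒1≤f (x ∷ xs) with P? x
  ... | yes px = +-mono-≤ (P⇒1≤f px) (length-filter≤sum-map P? f P⇒1≤f xs)
  ... | no _ = ≤-trans (length-filter≤sum-map P? f P⇒1≤f xs) (m≤n+m _ (f x))

module _ {n : ℕ} {P : Pred (Fin n) 0ℓ} (P? : U.Decidable P) where

  toSubset : Subset n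
  toSubset = tabulate (does ∘ P?)

  ∈-toSubset⁺ : ∀ {x} → P x → x ∈ toSubset
  ∈-toSubset⁺ {x} px = lookup⇒[]= x toSubset (trans (lookup∘tabulate (does ∘ P?) x) (dec-true (P? x) px))

  ∈-toSubset⁻ : ∀ {x} → x ∈ toSubset → P x
  ∈-toSubset⁻ {x} x∈ with P? x | trans (sym (lookup∘tabulate (does ∘ P?) x)) ([]=⇒lookup x∈)
  ... | yes px | _ = px
  ... | no _ | ()

x∈p∧y∈p∧x≢y⇒2≤∣p∣ : ∀ {n} {p : Subset n} {x y} → x ∈ p → y ∈ p → x ≢ y → 2 ≤ ∣ p ∣
x∈p∧y∈p∧x≢y⇒2≤∣p∣ {p = p} {x} {y} x∈p y∈p x≢y =
  subst (_< ∣ p ∣) (∣⁅x⁆∣≡1 x) (p⊂q⇒∣p∣<∣q∣ (⁅x⁆⊆p , y , y∈p , x≢y ∘ sym ∘ x∈⁅y⁆⇒x≡y x))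
  where
  ⁅x⁆⊆p : ∀ {z} → z ∈ ⁅ x ⁆ → z ∈ p
  ⁅x⁆⊆p z∈⁅x⁆ = subst (_∈ p) (sym (x∈⁅y⁆⇒x≡y x z∈⁅x⁆)) x∈p

module _ {m : ℕ} (D : Digraph m) where

  Arc? : Decidable (Arc D)
  Arc? u v = T? (D u v)

  indeg≡0 : ∀ {v} → (∀ u → ¬ Arc D u v) → IsRoot D v
  indeg≡0 {v} noParent = sum-map-zero _ (λ u → noArc (D u v) (noParent u)) (allFin m)
    where
    noArc : ∀ b → ¬ T b → (if b then 1 else 0) ≡ 0
    noArc false _ = refl
    noArc true ¬t = contradiction _ ¬t

  root-above : ∀ v → Acc (Arc D) v → ∃[ ρ ] (IsRoot D ρ × Reach D ρ v)
  root-above v (acc rs) with any? (λ u → Arc? u v)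
  ... | no noParent = v , indeg≡0 (λ u a → noParent (u , a)) , ε
  ... | yes (u , a) with root-above u (rs a)
  ... | ρ , root , ρ↝u = ρ , root , ρ↝u ◅◅ return a

  reach? : ∀ u v → Acc (Arc D) v → Dec (Reach D u v)
  reach? u v (acc rs) = map′ (Equivalence.from star-unsnoc) (Equivalence.to star-unsnoc) ((u ≟ v) ⊎-dec any? viaParent)
    where
    viaParent : ∀ w → Dec (Reach D u w × Arc D w v)
    viaParent w with Arc? w v
    ... | yes a = map′ (_, a) proj₁ (reach? u w (rs a))
    ... | no ¬a = no (¬a ∘ proj₂)

module RootCover {n m : ℕ} (D : Digraph m) (leaf : Fin n → Fin m) (acyclic : Acyclic D) where

  ancestors-wf : WellFounded (Arc D)
  ancestors-wf = acyclic⇒wellFounded (Arc? D) acyclic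

  leafBelow? : ∀ ρ → U.Decidable (λ x → Reach D ρ (leaf x))
  leafBelow? ρ x = reach? D ρ (leaf x) (ancestors-wf (leaf x))

  leavesBelow : Fin m → Subset n
  leavesBelow ρ = toSubset (leafBelow? ρ)

  CliqueRoot : Pred (Fin m) 0ℓ
  CliqueRoot ρ = IsRoot D ρ × 2 ≤ ∣ leavesBelow ρ ∣

  cliqueRoot? : U.Decidable CliqueRoot
  cliqueRoot? ρ = (indeg D ρ ≟ℕ 0) ×-dec (2 ≤?ℕ ∣ leavesBelow ρ ∣)

  rootCover : List (Subset n)
  rootCover = map leavesBelow (filter cliqueRoot? (allFin m))

  length-rootCover : length rootCover ≤ numRoots D
  length-rootCover = subst (_≤ numRoots D) (sym (length-map leavesBelow (filter cliqueRoot? (allFin m))))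
    (length-filter≤sum-map cliqueRoot? _ rootCounts (allFin m))
    where
    rootCounts : ∀ {ρ} → CliqueRoot ρ → 1 ≤ (if indeg D ρ ≡ᵇ 0 then 1 else 0)
    rootCounts (root , _) rewrite root = s≤s z≤n

  ∈-rootCover⁻ : ∀ {C} → C ∈ₗ rootCover →
                 2 ≤ ∣ C ∣ × (∀ {x y} → x ∈ C → y ∈ C → ∃[ v ] (Reach D v (leaf x) × Reach D v (leaf y)))
  ∈-rootCover⁻ C∈ with ∈-map∘filter⁻ leavesBelow cliqueRoot? {xs = allFin m} C∈
  ... | ρ , _ , refl , _ , 2≤∣C∣ = 2≤∣C∣ , λ x∈ y∈ → ρ , ∈-toSubset⁻ (leafBelow? ρ) x∈ , ∈-toSubset⁻ (leafBelow? ρ) y∈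

  rootCover-covers : ∀ {v x y} → Reach D v (leaf x) → Reach D v (leaf y) → x ≢ y →
                     ∃[ C ] (C ∈ₗ rootCover × x ∈ C × y ∈ C)
  rootCover-covers {v} v↝x v↝y x≢y with root-above D v (ancestors-wf v)
  ... | ρ , root , ρ↝v =
    leavesBelow ρ , ∈-map∘filter⁺ leavesBelow cliqueRoot? (ρ , ∈-allFin ρ , refl , root , 2≤∣C∣) , x∈ , y∈
    where
    x∈ = ∈-toSubset⁺ (leafBelow? ρ) (ρ↝v ◅◅ v↝x)
    y∈ = ∈-toSubset⁺ (leafBelow? ρ) (ρ↝v ◅◅ v↝y)
    2≤∣C∣ = x∈p∧y∈p∧x≢y⇒2≤∣p∣ x∈ y∈ x≢y

adj⇒≢ : ∀ {n} (G : Graph n) {x y} → Adj G x y → x ≢ y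
adj⇒≢ G xy refl = irrefl G xy

lemma4p3 : (n : ℕ) (G : Graph n) → Connected G →
           (m : ℕ) (D : Digraph m) (leaf : Fin n → Fin m) →
           IsNetwork n m D leaf → Represents D leaf G →
           ecc≤ G (numRoots D)
lemma4p3 n G _ m D leaf net rep = rootCover , (isClique , covers) , length-rootCover
  where
  open RootCover D leaf (IsNetwork.acyclic net)
  isClique : ∀ C → C ∈ₗ rootCover → IsClique G C
  isClique C C∈ with ∈-rootCover⁻ C∈
  ... | 2≤∣C∣ , commonAncestor =
    2≤∣C∣ , λ x y x∈ y∈ x≢y → Equivalence.from (rep x y x≢y) (commonAncestor x∈ y∈)
  covers : ∀ x y → Adj G x y → ∃[ C ] (C ∈ₗ rootCover × x ∈ C × y ∈ C)
  covers x y xy with Equivalence.to (rep x y (adj⇒≢ G xy)) xy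
  ... | v , v↝x , v↝y = rootCover-covers v↝x v↝y (adj⇒≢ G xy)
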